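{- Let $T$ be a rooted tree with $n$ vertices and root $r$, and let $S\subseteq V_T$ with $r\in S$. Then for every vertex $v\in V_T$, the number $|\{e_1,\dots,e_{c(v)}\}\cap\partial_{\vec{T}}(S)|$ is even if $v\in S$ and odd if $v\notin S$.
   Context: $\partial_T(S)$ is the set of edges of $T$ with exactly one endpoint in $S$. $\vec{T}$ is obtained from $T$ by replacing each edge by two directed edges of opposite orientation, and $\partial_{\vec{T}}(S)$ is the set of directed edges arising from edges of $\partial_T(S)$. Fix an Euler tour $e_1,\dots,e_{2n-2}$ of $\vec{T}$ starting at $r$. For $v\neq r$, $c(v)$ is the index $i$ such that $e_i$ is the directed edge from the parent of $v$ into $v$; $c(r)=0$ (so the corresponding prefix is empty). -}

module Defs where

open import Data.Nat using (ℕ; zero; suc; _+_; _∸_; _*_)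
open import Data.Fin using (Fin; toℕ)
open import Data.Fin.Subset using (Subset)
open import Data.Bool using (Bool; true; false; _xor_)
open import Data.Vec using (lookup)
open import Data.List using (List; []; _∷_; length; take)
open import Data.List.Membership.Propositional using (_∈_)
open import Data.List.Relation.Unary.All using (All)
open import Data.List.Relation.Unary.Unique.Propositional using (Unique)
open import Data.Product using (Σ; _×_; _,_; ∃)
open import Data.Sum using (_⊎_)
open import Relation.Binary.PropositionalEquality using (_≡_; _≢_)

iter : {A : Set} → (A → A) → ℕ → A → A
iter f zero    x = x
iter f (suc k) x = f (iter f k x)

-- A rooted tree on the vertex set Fin n, with root r, given by its parent
-- function (convention: parent r ≡ r).  The tree edges are {v , parent v}
-- for v ≢ r.  Every vertex reaches the root by following parents, which
-- forces acyclicity and connectivity.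
record RootedTree (n : ℕ) : Set where
  field
    root        : Fin n
    parent      : Fin n → Fin n
    parent-root : parent root ≡ root
    reaches     : ∀ v → ∃ λ k → iter parent k v ≡ root
open RootedTree public

-- directed edges as ordered pairs (tail , head)
DEdge : ℕ → Set
DEdge n = Fin n × Fin n

IsDEdge : ∀ {n} → RootedTree n → DEdge n → Set
IsDEdge T (a , b) = (b ≢ root T × parent T b ≡ a) ⊎ (a ≢ root T × parent T a ≡ b)

WalkFromTo : ∀ {n} → Fin n → Fin n → List (DEdge n) → Set
WalkFromTo x y []             = x ≡ y
WalkFromTo x y ((a , b) ∷ es) = x ≡ a × WalkFromTo b y es

IsEulerTour : ∀ {n} → RootedTree n → List (DEdge n) → Set
IsEulerTour T es =
  WalkFromTo (root T) (root T) es
  × All (IsDEdge T) es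
  × Unique es
  × (∀ e → IsDEdge T e → e ∈ es)

-- membership of a directed edge in ∂_{T⃗}(S): exactly one endpoint in S
-- (for directed edges of T⃗)
crosses : ∀ {n} → Subset n → DEdge n → Bool
crosses S (a , b) = lookup S a xor lookup S b

countBoundary : ∀ {n} → Subset n → List (DEdge n) → ℕ
countBoundary S []       = 0
countBoundary S (e ∷ es) with crosses S e
... | true  = suc (countBoundary S es)
... | false = countBoundary S es

-- c(v) ≡ k : k = 0 if v is the root; otherwise e_k (1-indexed) is the
-- directed edge from parent v into v.
IsEntryIndex : ∀ {n} → RootedTree n → List (DEdge n) → Fin n → ℕ → Set
IsEntryIndex T es v k =
  (v ≡ root T × k ≡ 0)
  ⊎ (v ≢ root T × Σ (Fin (length es)) λ i →
        (suc (toℕ i) ≡ k) × (Data.List.lookup es i ≡ (parent T v , v)))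

-- Crossing an edge of ∂(S) toggles membership in S, so along any walk the
-- number of boundary edges is even exactly when both ends lie on the same
-- side of S. The prefix e₁ … e_c(v) of the Euler tour is a walk from the
-- root, which is in S, to v.
module Submission where

open import Defs
open import Data.Nat using (ℕ; suc; _%_)
open import Data.Nat.DivMod using (%-distribˡ-+)
open import Data.Fin using (Fin; toℕ)
import Data.Fin as Fin
open import Data.Fin.Subset using (Subset; _∈_; _∉_)
open import Data.List using (List; []; _∷_; take; length)
import Data.List as List
open import Data.Vec using (lookup)
open import Data.Vec.Properties using ([]=⇒lookup; lookup⇒[]=)
open import Data.Bool using (Bool; true; false; not; _xor_)
open import Data.Bool.Properties using (xor-assoc; xor-same)
open import Data.Product using (_×_; _,_; proj₂)
open import Data.Sum using (inj₁; inj₂)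
open import Relation.Nullary using (contradiction)
open import Relation.Binary.PropositionalEquality
  using (_≡_; refl; sym; trans; cong; subst; module ≡-Reasoning)

bit : Bool → ℕ
bit false = 0
bit true  = 1

suc-%2 : ∀ m b → m % 2 ≡ bit b → suc m % 2 ≡ bit (not b)
suc-%2 m b m%2 = trans (%-distribˡ-+ 1 m 2) (flip b m%2)
  where
  flip : ∀ b → m % 2 ≡ bit b → suc (m % 2) % 2 ≡ bit (not b)
  flip false eq rewrite eq = refl
  flip true  eq rewrite eq = refl

xor-telescope : ∀ x y z → (x xor y) xor (y xor z) ≡ x xor z
xor-telescope x y z = begin
  (x xor y) xor (y xor z)  ≡⟨ xor-assoc x y (y xor z) ⟩
  x xor (y xor (y xor z))  ≡⟨ cong (x xor_) (sym (xor-assoc y y z)) ⟩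
  x xor ((y xor y) xor z)  ≡⟨ cong (λ w → x xor (w xor z)) (xor-same y) ⟩
  x xor z                  ∎
  where open ≡-Reasoning

countBoundary-∷-%2 : ∀ {n} (S : Subset n) e (es : List (DEdge n)) b →
  countBoundary S es % 2 ≡ bit b →
  countBoundary S (e ∷ es) % 2 ≡ bit (crosses S e xor b)
countBoundary-∷-%2 S e es b es%2 with crosses S e
... | true  = suc-%2 (countBoundary S es) b es%2
... | false = es%2

countBoundary-walk-%2 : ∀ {n} (S : Subset n) {x y} (es : List (DEdge n)) →
  WalkFromTo x y es →
  countBoundary S es % 2 ≡ bit (lookup S x xor lookup S y)
countBoundary-walk-%2 S {x} [] refl rewrite xor-same (lookup S x) = refl
countBoundary-walk-%2 S {x} {y} ((.x , b) ∷ es) (refl , walk) =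
  subst (λ t → countBoundary S ((x , b) ∷ es) % 2 ≡ bit t)
        (xor-telescope (lookup S x) (lookup S b) (lookup S y))
        (countBoundary-∷-%2 S (x , b) es _ (countBoundary-walk-%2 S es walk))

WalkFromTo-take : ∀ {n} {x y} (es : List (DEdge n)) → WalkFromTo x y es →
  (i : Fin (length es)) {a b : Fin n} → List.lookup es i ≡ (a , b) →
  WalkFromTo x b (take (suc (toℕ i)) es)
WalkFromTo-take (_ ∷ _)  (x≡a , _)    Fin.zero    eᵢ = x≡a , cong proj₂ eᵢ
WalkFromTo-take (_ ∷ es) (x≡a , walk) (Fin.suc i) eᵢ = x≡a , WalkFromTo-take es walk i eᵢ

parity-by-membership : ∀ {n} (S : Subset n) v m → m % 2 ≡ bit (not (lookup S v)) →
  (v ∈ S → m % 2 ≡ 0) × (v ∉ S → m % 2 ≡ 1)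
parity-by-membership S v m m%2 with lookup S v in Sv
... | true  = (λ _ → m%2) , (λ v∉S → contradiction (lookup⇒[]= v S Sv) v∉S)
... | false = (λ v∈S → contradiction (trans (sym Sv) ([]=⇒lookup v∈S)) λ ()) , (λ _ → m%2)

lemma9 : (n : ℕ) (T : RootedTree n) (S : Subset n) → root T ∈ S →
    (es : List (DEdge n)) → IsEulerTour T es →
    (v : Fin n) (c : ℕ) → IsEntryIndex T es v c →
    (v ∈ S → countBoundary S (take c es) % 2 ≡ 0)
    × (v ∉ S → countBoundary S (take c es) % 2 ≡ 1)
lemma9 n T S r∈S es tour v .0 (inj₁ (refl , refl)) =
  (λ _ → refl) , (λ r∉S → contradiction r∈S r∉S)
lemma9 n T S r∈S es (closed , _) v _ (inj₂ (_ , i , refl , eᵢ)) =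
  parity-by-membership S v (countBoundary S prefix) prefix-%2
  where
  prefix : List (DEdge n)
  prefix = take (suc (toℕ i)) es
  prefix-%2 : countBoundary S prefix % 2 ≡ bit (not (lookup S v))
  prefix-%2 = subst (λ s → countBoundary S prefix % 2 ≡ bit (s xor lookup S v))
                    ([]=⇒lookup r∈S)
                    (countBoundary-walk-%2 S prefix (WalkFromTo-take es closed i eᵢ))
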